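{- Let $n \ge 2$, $V=\{1,\dots,n\}$, and let $\tau : V \to \{1,\dots,n\}$ be a bijection (e.g. a uniformly random permutation). Let $G_n$ be the graph on $V$ obtained by inserting vertices in increasing order of $\tau$, each newly inserted vertex $x$ being joined by an undirected edge to the largest $y<x$ with $\tau(y)<\tau(x)$ (if any) and to the smallest $y>x$ with $\tau(y)<\tau(x)$ (if any); let $N_G(x)$ be the neighbourhood of $x$. The greedy walk from $1$ to $n$ is the sequence $x_0=1, x_1, x_2,\dots$ where, while $x_i \ne n$, $x_{i+1}=\arg\min_{y\in N_G(x_i)}|y-n|$; it stops upon reaching $n$, and $S_n$ denotes its number of steps. Let $m=\arg\min_{z\in V}\tau(z)$. A position $i$ is a left-to-right minimum of $\tau$ if $\tau(i)<\min\{\tau(1),\dots,\tau(i-1)\}$ (position $1$ always is), and a right-to-left minimum if $\tau(i)<\min\{\tau(i+1),\dots,\tau(n)\}$ (position $n$ always is); let $L_n$ and $R_n$ be the numbers of left-to-right and right-to-left minima of $\tau$. Then the greedy walk visits exactly: first all left-to-right minima of $\tau$, in increasing order from $1$ to $m$, and then all right-to-left minima of $\tau$ strictly greater than $m$, in increasing order up to $n$. Consequently \[ S_n = L_n + R_n - 2 . \] -}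

module Defs where

open import Data.Nat as ℕ using (ℕ; suc; ∣_-_∣)
open import Data.Fin using (Fin; zero; fromℕ; toℕ; _<_)
open import Data.Fin.Properties using (_<?_; all?)
open import Data.List using (List; []; _∷_; filter; length; _++_)
open import Data.List using (allFin) public
open import Data.Product using (_×_)
open import Data.Sum using (_⊎_)
open import Relation.Nullary using (¬_; Dec)
open import Relation.Nullary.Decidable using (_→-dec_; _×-dec_; ¬?)
open import Relation.Binary.PropositionalEquality using (_≡_; _≢_)

-- Vertices are Fin N (0-indexed: vertex i of the paper is Fin-element i-1).
-- τ : Fin N → Fin N is the insertion order (insertion time τ x).

-- "Link τ x y": when x is inserted, it gets joined to the (already inserted) y,
-- i.e. τ y < τ x and y is the largest y < x with τ y < τ x, or the smallest
-- y > x with τ y < τ x.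
Link : ∀ {N} → (Fin N → Fin N) → Fin N → Fin N → Set
Link τ x y =
  τ y < τ x ×
  ((y < x × (∀ z → y < z → z < x → ¬ (τ z < τ x)))
   ⊎ (x < y × (∀ z → x < z → z < y → ¬ (τ z < τ x))))

Adj : ∀ {N} → (Fin N → Fin N) → Fin N → Fin N → Set
Adj τ x y = Link τ x y ⊎ Link τ y x

GreedyStep : ∀ {N} → (Fin N → Fin N) → Fin N → Fin N → Fin N → Set
GreedyStep τ t x y =
  Adj τ x y × (∀ z → Adj τ x z → ∣ toℕ y - toℕ t ∣ ℕ.≤ ∣ toℕ z - toℕ t ∣)

data GreedyWalkFrom {N} (τ : Fin N → Fin N) (t : Fin N) : Fin N → List (Fin N) → Set where
  stop : ∀ {x} → x ≡ t → GreedyWalkFrom τ t x (x ∷ [])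
  step : ∀ {x y ys} → x ≢ t → GreedyStep τ t x y → GreedyWalkFrom τ t y ys →
         GreedyWalkFrom τ t x (x ∷ ys)

-- The greedy walk from vertex 1 (= zero) to vertex n (= fromℕ k) on Fin (suc k).
GreedyWalk : ∀ {k} → (Fin (suc k) → Fin (suc k)) → List (Fin (suc k)) → Set
GreedyWalk {k} τ w = GreedyWalkFrom τ (fromℕ k) zero w

steps : ∀ {A : Set} → List A → ℕ
steps w = length w ℕ.∸ 1

LRMin : ∀ {N} → (Fin N → Fin N) → Fin N → Set
LRMin τ i = ∀ j → j < i → τ i < τ j

RLMin : ∀ {N} → (Fin N → Fin N) → Fin N → Set
RLMin τ i = ∀ j → i < j → τ i < τ j

LRMin? : ∀ {N} (τ : Fin N → Fin N) i → Dec (LRMin τ i)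
LRMin? τ i = all? (λ j → (j <? i) →-dec (τ i <? τ j))

RLMin? : ∀ {N} (τ : Fin N → Fin N) i → Dec (RLMin τ i)
RLMin? τ i = all? (λ j → (i <? j) →-dec (τ i <? τ j))

lrMins : ∀ {N} → (Fin N → Fin N) → List (Fin N)
lrMins τ = filter (LRMin? τ) (allFin _)

rlMinsAbove : ∀ {N} → (Fin N → Fin N) → Fin N → List (Fin N)
rlMinsAbove τ m = filter (λ i → RLMin? τ i ×-dec (m <? i)) (allFin _)

rlMins : ∀ {N} → (Fin N → Fin N) → List (Fin N)
rlMins τ = filter (RLMin? τ) (allFin _)

Lcount Rcount : ∀ {N} → (Fin N → Fin N) → ℕ
Lcount τ = length (lrMins τ)
Rcount τ = length (rlMins τ)

{-# OPTIONS --safe #-}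
-- An edge {x, z} is created when the later of x and z is inserted, and then no vertex strictly
-- between them has been inserted yet.  Since the target n is the last vertex, the greedy walk
-- always moves to the rightmost neighbour.  From a left-to-right minimum x left of m, that is
-- the first vertex to the right of x inserted before x, i.e. the next left-to-right minimum;
-- from a right-to-left minimum x it is the first-inserted vertex to the right of x, i.e. the
-- next right-to-left minimum.  Greedy steps are unique, so this is the only greedy walk, and it
-- has L + R − 2 steps because m is both a left-to-right and a right-to-left minimum.
module Submission where

open import Defs
open import Data.Nat using (ℕ; suc; _+_; _∸_)
open import Data.Fin using (Fin; _≤_)
open import Data.List using (_++_)
open import Data.Product using (_×_)
open import Function.Bundles using (_↔_; Inverse)
open import Relation.Binary.PropositionalEquality using (_≡_)

open import Data.Empty using (⊥-elim)
open import Data.Fin using (zero; toℕ; fromℕ; _<_; _>_)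
open import Data.Fin.Induction using (>-wellFounded)
open import Data.Fin.Properties
  using (_≟_; _<?_; _≤?_; toℕ-injective; ≤fromℕ; ≤-refl; ≤∧≢⇒<; <⇒≢; <-asym; <-trans; <-cmp)
open import Data.List using (List; []; _∷_; filter; length)
open import Data.List.Properties using (length-++; filter-≐)
open import Data.List.Membership.Propositional using (_∈_)
open import Data.List.Membership.Propositional.Properties using (∈-filter⁺; ∈-filter⁻; ∈-allFin)
open import Data.List.Relation.Binary.Subset.Propositional using (_⊆_)
open import Data.List.Relation.Unary.All as All using (All)
open import Data.List.Relation.Unary.AllPairs using (AllPairs; []; _∷_)
open import Data.List.Relation.Unary.AllPairs.Properties using (filter⁺; tabulate⁺-<)
open import Data.List.Relation.Unary.Any using (here; there)
import Data.Nat as ℕ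
import Data.Nat.Properties as ℕ
open import Data.Product using (∃; _,_; proj₁; proj₂)
open import Data.Sum using (_⊎_; inj₁; inj₂)
open import Function using (_∘_; id)
open import Function.Bundles using (Injection)
open import Function.Properties.Inverse using (↔⇒↣)
open import Induction.WellFounded using (Acc; acc)
open import Relation.Binary.Core using (Rel)
open import Relation.Binary.Definitions using (Asymmetric; tri<; tri≈; tri>)
open import Relation.Binary.PropositionalEquality
  using (refl; sym; trans; cong; subst; _≢_; module ≡-Reasoning)
open import Relation.Nullary using (¬_; yes; no)
open import Relation.Nullary.Decidable using (_×-dec_)
open import Relation.Unary using (Pred; Decidable)

module _ {a r} {A : Set a} {_≺_ : Rel A r} (≺-asym : Asymmetric _≺_) where

  sorted-heads-≡ : ∀ {x y xs ys} → All (x ≺_) xs → All (y ≺_) ys →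
    x ∈ y ∷ ys → y ∈ x ∷ xs → x ≡ y
  sorted-heads-≡ _    _    (here x≡y)   _            = x≡y
  sorted-heads-≡ _    _    (there _)    (here y≡x)   = sym y≡x
  sorted-heads-≡ x≺xs y≺ys (there x∈ys) (there y∈xs) =
    ⊥-elim (≺-asym (All.lookup x≺xs y∈xs) (All.lookup y≺ys x∈ys))

  ⊆-∷ʳ⁻ : ∀ {z zs us} → All (z ≺_) zs → zs ⊆ z ∷ us → zs ⊆ us
  ⊆-∷ʳ⁻ z≺zs zs⊆ u∈zs with zs⊆ u∈zs
  ... | here refl  = ⊥-elim (≺-asym (All.lookup z≺zs u∈zs) (All.lookup z≺zs u∈zs))
  ... | there u∈us = u∈us

  strictlySorted-⊆∧⊇⇒≡ : ∀ {xs ys} → AllPairs _≺_ xs → AllPairs _≺_ ys →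
    xs ⊆ ys → ys ⊆ xs → xs ≡ ys
  strictlySorted-⊆∧⊇⇒≡ {[]}     {[]}     _ _ _ _ = refl
  strictlySorted-⊆∧⊇⇒≡ {[]}     {_ ∷ _} _ _ _ ys⊆xs with () ← ys⊆xs (here refl)
  strictlySorted-⊆∧⊇⇒≡ {_ ∷ _} {[]}     _ _ xs⊆ys _ with () ← xs⊆ys (here refl)
  strictlySorted-⊆∧⊇⇒≡ {x ∷ xs} {y ∷ ys} (x≺xs ∷ xs↗) (y≺ys ∷ ys↗) xs⊆ys ys⊆xs
    with sorted-heads-≡ x≺xs y≺ys (xs⊆ys (here refl)) (ys⊆xs (here refl))
  ... | refl = cong (x ∷_)
    (strictlySorted-⊆∧⊇⇒≡ xs↗ ys↗ (⊆-∷ʳ⁻ x≺xs (xs⊆ys ∘ there))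
                                  (⊆-∷ʳ⁻ y≺ys (ys⊆xs ∘ there)))

∃⟶∃-smallest : ∀ {N p} {P : Pred (Fin N) p} → Decidable P → ∃ P →
               ∃ λ i → P i × (∀ {j} → j < i → ¬ P j)
∃⟶∃-smallest {suc N} {P = P} P? (w , Pw) with P? zero | w
... | yes P0 | _ = zero , P0 , λ ()
... | no ¬P0 | zero = ⊥-elim (¬P0 Pw)
... | no ¬P0 | Fin.suc w′ with ∃⟶∃-smallest (P? ∘ Fin.suc) (w′ , Pw)
...   | i , Pi , i-smallest = Fin.suc i , Pi , smallest
  where
  smallest : ∀ {j} → j < Fin.suc i → ¬ P j
  smallest {zero}      _             = ¬P0
  smallest {Fin.suc j} (ℕ.s≤s j<i) = i-smallest j<i

filter-allFin-sorted : ∀ {N p} {P : Pred (Fin N) p} (P? : Decidable P) →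
                       AllPairs _<_ (filter P? (allFin N))
filter-allFin-sorted P? = filter⁺ P? (tabulate⁺-< id)

module _ {N p} {P : Pred (Fin N) p} (P? : Decidable P) where

  filter-allFin-≡ : ∀ {xs} → AllPairs _<_ xs →
    (∀ {i} → i ∈ xs → P i) → (∀ {i} → P i → i ∈ xs) → filter P? (allFin N) ≡ xs
  filter-allFin-≡ xs↗ sound complete =
    strictlySorted-⊆∧⊇⇒≡ <-asym (filter-allFin-sorted P?) xs↗
    (complete ∘ proj₂ ∘ ∈-filter⁻ P? {xs = allFin N})
    (λ i∈xs → ∈-filter⁺ P? (∈-allFin _) (sound i∈xs))

  filter-allFin-∷ : ∀ {q} {Q : Pred (Fin N) q} (Q? : Decidable Q) {y} → P y →
    (∀ {i} → Q i → P i × y < i) → (∀ {i} → P i → i ≡ y ⊎ Q i) →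
    filter P? (allFin N) ≡ y ∷ filter Q? (allFin N)
  filter-allFin-∷ {Q = Q} Q? {y} Py Q⇒P∧y< P⇒y∨Q =
    filter-allFin-≡ (All.tabulate (proj₂ ∘ Q⇒P∧y< ∘ Q-of) ∷ filter-allFin-sorted Q?)
      sound complete
    where
    Q-of : ∀ {i} → i ∈ filter Q? (allFin N) → Q i
    Q-of = proj₂ ∘ ∈-filter⁻ Q? {xs = allFin N}
    sound : ∀ {i} → i ∈ y ∷ filter Q? (allFin N) → P i
    sound (here refl) = Py
    sound (there i∈)  = proj₁ (Q⇒P∧y< (Q-of i∈))
    complete : ∀ {i} → P i → i ∈ y ∷ filter Q? (allFin N)
    complete Pi with P⇒y∨Q Pi
    ... | inj₁ refl = here refl
    ... | inj₂ Qi   = there (∈-filter⁺ Q? (∈-allFin _) Qi)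

module _ {N} (τ : Fin N → Fin N) where

  Adj⇒interior-later : ∀ {x y z} → Adj τ x z → x < y → y < z → τ x ≤ τ y × τ z ≤ τ y
  Adj⇒interior-later (inj₁ (τz<τx , inj₂ (_ , nothing-below-τx))) x<y y<z =
    let τx≤τy = ℕ.≮⇒≥ (nothing-below-τx _ x<y y<z)
    in  τx≤τy , ℕ.<⇒≤ (ℕ.<-≤-trans τz<τx τx≤τy)
  Adj⇒interior-later (inj₂ (τx<τz , inj₁ (_ , nothing-below-τz))) x<y y<z =
    let τz≤τy = ℕ.≮⇒≥ (nothing-below-τz _ x<y y<z)
    in  ℕ.<⇒≤ (ℕ.<-≤-trans τx<τz τz≤τy) , τz≤τy
  Adj⇒interior-later (inj₁ (_ , inj₁ (z<x , _))) x<y y<z = ⊥-elim (<-asym z<x (<-trans x<y y<z))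
  Adj⇒interior-later (inj₂ (_ , inj₂ (z<x , _))) x<y y<z = ⊥-elim (<-asym z<x (<-trans x<y y<z))

LRMinFrom? : ∀ {N} (τ : Fin N → Fin N) (x : Fin N) → Decidable (λ i → LRMin τ i × x ≤ i)
LRMinFrom? τ x i = LRMin? τ i ×-dec (x ≤? i)

RLMinAbove? : ∀ {N} (τ : Fin N → Fin N) (x : Fin N) → Decidable (λ i → RLMin τ i × x < i)
RLMinAbove? τ x i = RLMin? τ i ×-dec (x <? i)

lrMinsFrom : ∀ {N} → (Fin N → Fin N) → Fin N → List (Fin N)
lrMinsFrom {N} τ x = filter (LRMinFrom? τ x) (allFin N)

module Greedy {n} (τ : Fin (suc n) → Fin (suc n)) where

  last : Fin (suc n)
  last = fromℕ n

  <⇒≢last : ∀ {x y : Fin (suc n)} → x < y → x ≢ last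
  <⇒≢last {y = y} x<y refl = ℕ.<⇒≱ x<y (≤fromℕ y)

  distance-to-last : ∀ y → ℕ.∣ toℕ y - toℕ last ∣ ≡ toℕ last ∸ toℕ y
  distance-to-last y = ℕ.m≤n⇒∣m-n∣≡n∸m (≤fromℕ y)

  greedyStep-rightmost : ∀ {x y} → Adj τ x y → (∀ {z} → Adj τ x z → ¬ y < z) →
                         GreedyStep τ last x y
  greedyStep-rightmost {x} {y} x~y nothing-beyond = x~y , closest
    where
    open ℕ.≤-Reasoning
    closest : ∀ z → Adj τ x z → ℕ.∣ toℕ y - toℕ last ∣ ℕ.≤ ℕ.∣ toℕ z - toℕ last ∣
    closest z x~z = begin
      ℕ.∣ toℕ y - toℕ last ∣ ≡⟨ distance-to-last y ⟩
      toℕ last ∸ toℕ y       ≤⟨ ℕ.∸-monoʳ-≤ (toℕ last) (ℕ.≮⇒≥ (nothing-beyond x~z)) ⟩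
      toℕ last ∸ toℕ z       ≡⟨ distance-to-last z ⟨
      ℕ.∣ toℕ z - toℕ last ∣ ∎

  greedyStep-unique : ∀ {x y y′} → GreedyStep τ last x y → GreedyStep τ last x y′ → y ≡ y′
  greedyStep-unique {y = y} {y′} (x~y , y-closest) (x~y′ , y′-closest) =
    toℕ-injective (ℕ.∸-cancelˡ-≡ (≤fromℕ y) (≤fromℕ y′) same-distance)
    where
    open ≡-Reasoning
    same-distance : toℕ last ∸ toℕ y ≡ toℕ last ∸ toℕ y′
    same-distance = begin
      toℕ last ∸ toℕ y        ≡⟨ distance-to-last y ⟨
      ℕ.∣ toℕ y - toℕ last ∣  ≡⟨ ℕ.≤-antisym (y-closest y′ x~y′) (y′-closest y x~y) ⟩
      ℕ.∣ toℕ y′ - toℕ last ∣ ≡⟨ distance-to-last y′ ⟩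
      toℕ last ∸ toℕ y′       ∎

  greedyWalk-unique : ∀ {x w w′} → GreedyWalkFrom τ last x w → GreedyWalkFrom τ last x w′ →
                      w ≡ w′
  greedyWalk-unique (stop _)          (stop _)          = refl
  greedyWalk-unique (stop x≡last)     (step x≢last _ _) = ⊥-elim (x≢last x≡last)
  greedyWalk-unique (step x≢last _ _) (stop x≡last)     = ⊥-elim (x≢last x≡last)
  greedyWalk-unique (step _ s w)      (step _ s′ w′) with greedyStep-unique s s′
  ... | refl = cong (_ ∷_) (greedyWalk-unique w w′)

  rlMinsAbove-last : rlMinsAbove τ last ≡ []
  rlMinsAbove-last = filter-allFin-≡ (RLMinAbove? τ last) [] (λ ())
    (λ (_ , last<i) → ⊥-elim (ℕ.≤⇒≯ (≤fromℕ _) last<i))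

  lrMinsFrom-zero : lrMinsFrom τ zero ≡ lrMins τ
  lrMinsFrom-zero = filter-≐ (LRMinFrom? τ zero) (LRMin? τ) (proj₁ , (_, ℕ.z≤n)) (allFin _)

  FirstRightBelow : Fin (suc n) → Fin (suc n) → Set
  FirstRightBelow x y = x < y × τ y < τ x × (∀ {z} → x < z → z < y → τ x ≤ τ z)

  firstRightBelow : ∀ {x} → (∃ λ z → x < z × τ z < τ x) → ∃ (FirstRightBelow x)
  firstRightBelow {x} right-below
    with ∃⟶∃-smallest (λ z → (x <? z) ×-dec (τ z <? τ x)) right-below
  ... | y , (x<y , τy<τx) , y-smallest =
    y , x<y , τy<τx , λ x<z z<y → ℕ.≮⇒≥ (λ τz<τx → y-smallest z<y (x<z , τz<τx))

  firstRightBelow-greedyStep : ∀ {x y} → FirstRightBelow x y → GreedyStep τ last x y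
  firstRightBelow-greedyStep (x<y , τy<τx , y-first) = greedyStep-rightmost
    (inj₁ (τy<τx , inj₂ (x<y , λ _ x<z z<y → ℕ.≤⇒≯ (y-first x<z z<y))))
    (λ x~z y<z → ℕ.≤⇒≯ (proj₁ (Adj⇒interior-later τ x~z x<y y<z)) τy<τx)

  firstRightBelow-LRMin : ∀ {x y} → LRMin τ x → FirstRightBelow x y → LRMin τ y
  firstRightBelow-LRMin {x} x-lr (_ , τy<τx , y-first) j j<y with <-cmp j x
  ... | tri< j<x _ _  = <-trans τy<τx (x-lr j j<x)
  ... | tri≈ _ refl _ = τy<τx
  ... | tri> _ _ x<j  = ℕ.<-≤-trans τy<τx (y-first x<j j<y)

  lrMinsFrom-firstRightBelow : ∀ {x y} → LRMin τ x → FirstRightBelow x y →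
                               lrMinsFrom τ x ≡ x ∷ lrMinsFrom τ y
  lrMinsFrom-firstRightBelow {x} {y} x-lr (x<y , _ , y-first) =
    filter-allFin-∷ (LRMinFrom? τ x) (LRMinFrom? τ y) (x-lr , ≤-refl)
      (λ (i-lr , y≤i) → let x<i = ℕ.<-≤-trans x<y y≤i in (i-lr , ℕ.<⇒≤ x<i) , x<i)
      split
    where
    split : ∀ {i} → LRMin τ i × x ≤ i → i ≡ x ⊎ LRMin τ i × y ≤ i
    split {i} (i-lr , x≤i) with i ≟ x
    ... | yes i≡x = inj₁ i≡x
    ... | no i≢x  = inj₂ (i-lr , ℕ.≮⇒≥ (λ i<y → ℕ.≤⇒≯ (y-first x<i i<y) (i-lr x x<i)))
      where
      x<i : x < i
      x<i = ≤∧≢⇒< x≤i (i≢x ∘ sym)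

module InsertionOrder {n} (τ : Fin (suc n) ↔ Fin (suc n)) where
  open Inverse τ using (to; from; strictlyInverseˡ; strictlyInverseʳ)
  open Greedy to

  to-injective : ∀ {x y} → to x ≡ to y → x ≡ y
  to-injective = Injection.injective (↔⇒↣ τ)

  FirstRightOf : Fin (suc n) → Fin (suc n) → Set
  FirstRightOf x y = x < y × (∀ {z} → x < z → to y ≤ to z)

  firstRightOf : ∀ {x} → x ≢ last → ∃ (FirstRightOf x)
  firstRightOf {x} x≢last
    with ∃⟶∃-smallest (λ v → x <? from v)
           (to last , subst (x <_) (sym (strictlyInverseʳ last)) (≤∧≢⇒< (≤fromℕ x) x≢last))
  ... | v , x<y , v-smallest = from v , x<y , λ {z} x<z →
    subst (_≤ to z) (sym (strictlyInverseˡ v))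
      (ℕ.≮⇒≥ (λ z<v → v-smallest z<v (subst (x <_) (sym (strictlyInverseʳ z)) x<z)))

  firstRightOf-RLMin : ∀ {x y} → FirstRightOf x y → RLMin to y
  firstRightOf-RLMin (x<y , y-min) j y<j =
    ≤∧≢⇒< (y-min (<-trans x<y y<j)) (<⇒≢ y<j ∘ to-injective)

  firstRightOf-greedyStep : ∀ {x y} → RLMin to x → FirstRightOf x y → GreedyStep to last x y
  firstRightOf-greedyStep x-rl y-first@(x<y , y-min) = greedyStep-rightmost
    (inj₂ (x-rl _ x<y , inj₁ (x<y , λ _ x<z z<y → ℕ.≤⇒≯ (y-min x<z))))
    (λ x~z y<z → ℕ.≤⇒≯ (proj₂ (Adj⇒interior-later to x~z x<y y<z))
                        (firstRightOf-RLMin y-first _ y<z))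

  rlMinsAbove-firstRightOf : ∀ {x y} → FirstRightOf x y → rlMinsAbove to x ≡ y ∷ rlMinsAbove to y
  rlMinsAbove-firstRightOf {x} {y} y-first@(x<y , y-min) =
    filter-allFin-∷ (RLMinAbove? to x) (RLMinAbove? to y) (firstRightOf-RLMin y-first , x<y)
      (λ (i-rl , y<i) → (i-rl , <-trans x<y y<i) , y<i)
      split
    where
    split : ∀ {i} → RLMin to i × x < i → i ≡ y ⊎ RLMin to i × y < i
    split {i} (i-rl , x<i) with <-cmp i y
    ... | tri< i<y _ _ = ⊥-elim (ℕ.≤⇒≯ (y-min x<i) (i-rl y i<y))
    ... | tri≈ _ i≡y _ = inj₁ i≡y
    ... | tri> _ _ y<i = inj₂ (i-rl , y<i)

  greedyWalk-rlMin : ∀ {x} → RLMin to x → GreedyWalkFrom to last x (x ∷ rlMinsAbove to x)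
  greedyWalk-rlMin = walk (>-wellFounded _)
    where
    walk : ∀ {x} → Acc _>_ x → RLMin to x → GreedyWalkFrom to last x (x ∷ rlMinsAbove to x)
    walk {x} (acc later) x-rl with x ≟ last
    ... | yes refl rewrite rlMinsAbove-last = stop refl
    ... | no x≢last with firstRightOf x≢last
    ... | y , y-first rewrite rlMinsAbove-firstRightOf y-first =
      step x≢last (firstRightOf-greedyStep x-rl y-first)
        (walk (later (proj₁ y-first)) (firstRightOf-RLMin y-first))

  module FirstInserted {m} (m-first : ∀ z → to m ≤ to z) where

    m-strictly-first : ∀ {z} → z ≢ m → to m < to z
    m-strictly-first z≢m = ≤∧≢⇒< (m-first _) (z≢m ∘ sym ∘ to-injective)

    m-LRMin : LRMin to m
    m-LRMin j j<m = m-strictly-first (<⇒≢ j<m)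

    m-RLMin : RLMin to m
    m-RLMin j m<j = m-strictly-first (<⇒≢ m<j ∘ sym)

    rlMins-split : rlMins to ≡ m ∷ rlMinsAbove to m
    rlMins-split = filter-allFin-∷ (RLMin? to) (RLMinAbove? to m) m-RLMin id split
      where
      split : ∀ {i} → RLMin to i → i ≡ m ⊎ RLMin to i × m < i
      split {i} i-rl with <-cmp i m
      ... | tri< i<m _ _ = ⊥-elim (ℕ.≤⇒≯ (m-first i) (i-rl m i<m))
      ... | tri≈ _ i≡m _ = inj₁ i≡m
      ... | tri> _ _ m<i = inj₂ (i-rl , m<i)

    lrMinsFrom-m : lrMinsFrom to m ≡ m ∷ []
    lrMinsFrom-m = filter-allFin-≡ (LRMinFrom? to m) (All.[] ∷ [])
      (λ { (here refl) → m-LRMin , ≤-refl }) only-m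
      where
      only-m : ∀ {i} → LRMin to i × m ≤ i → i ∈ m ∷ []
      only-m {i} (i-lr , m≤i) with i ≟ m
      ... | yes i≡m = here i≡m
      ... | no i≢m  = ⊥-elim (ℕ.≤⇒≯ (m-first i) (i-lr m (≤∧≢⇒< m≤i (i≢m ∘ sym))))

    firstRightBelow-≤m : ∀ {x y} → FirstRightBelow x y → x < m → y ≤ m
    firstRightBelow-≤m (_ , _ , y-first) x<m =
      ℕ.≮⇒≥ (λ m<y → ℕ.≤⇒≯ (y-first x<m m<y) (m-strictly-first (<⇒≢ x<m)))

    greedyWalk-lrMin : ∀ {x} → LRMin to x → x ≤ m →
                       GreedyWalkFrom to last x (lrMinsFrom to x ++ rlMinsAbove to m)
    greedyWalk-lrMin = walk (>-wellFounded _)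
      where
      walk : ∀ {x} → Acc _>_ x → LRMin to x → x ≤ m →
             GreedyWalkFrom to last x (lrMinsFrom to x ++ rlMinsAbove to m)
      walk {x} (acc later) x-lr x≤m with x ≟ m
      ... | yes refl rewrite lrMinsFrom-m = greedyWalk-rlMin m-RLMin
      ... | no x≢m with firstRightBelow (m , ≤∧≢⇒< x≤m x≢m , m-strictly-first x≢m)
      ... | y , y-first rewrite lrMinsFrom-firstRightBelow x-lr y-first =
        step (<⇒≢last (proj₁ y-first)) (firstRightBelow-greedyStep y-first)
          (walk (later (proj₁ y-first)) (firstRightBelow-LRMin x-lr y-first)
            (firstRightBelow-≤m y-first (≤∧≢⇒< x≤m x≢m)))

    greedyWalk-minima : GreedyWalk to (lrMins to ++ rlMinsAbove to m)
    greedyWalk-minima = subst (λ w → GreedyWalk to (w ++ rlMinsAbove to m)) lrMinsFrom-zero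
      (greedyWalk-lrMin (λ _ ()) ℕ.z≤n)

    steps-minima : steps (lrMins to ++ rlMinsAbove to m) ≡ Lcount to + Rcount to ∸ 2
    steps-minima = begin
      length (lrMins to ++ rlMinsAbove to m) ∸ 1     ≡⟨ cong (_∸ 1) (length-++ (lrMins to)) ⟩
      Lcount to + length (rlMinsAbove to m) ∸ 1      ≡⟨ cong (_∸ 2) (ℕ.+-suc (Lcount to) _) ⟨
      Lcount to + length (m ∷ rlMinsAbove to m) ∸ 2  ≡⟨ cong (λ ms → Lcount to + length ms ∸ 2) rlMins-split ⟨
      Lcount to + Rcount to ∸ 2                      ∎
      where open ≡-Reasoning

theorem4p3 : (k : ℕ) → (τ : Fin (suc (suc k)) ↔ Fin (suc (suc k))) → (m : Fin (suc (suc k))) →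
    (∀ z → Inverse.to τ m ≤ Inverse.to τ z) →
    GreedyWalk (Inverse.to τ) (lrMins (Inverse.to τ) ++ rlMinsAbove (Inverse.to τ) m)
    × (∀ w → GreedyWalk (Inverse.to τ) w →
         w ≡ lrMins (Inverse.to τ) ++ rlMinsAbove (Inverse.to τ) m
         × steps w ≡ Lcount (Inverse.to τ) + Rcount (Inverse.to τ) ∸ 2)
theorem4p3 k τ m m-first = greedyWalk-minima , λ w w-greedy →
  let w≡minima = greedyWalk-unique w-greedy greedyWalk-minima
  in  w≡minima , trans (cong steps w≡minima) steps-minima
  where
  open Greedy (Inverse.to τ) using (greedyWalk-unique)
  open InsertionOrder τ
  open FirstInserted m-first
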